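{- Let $S$ be a partial semigroup and for $i=0,1$ let $\mathcal{S}_i$ be a function array over $S$ indexed by a finite set $\Lambda_i$ and based on a set $X_i$. Then there is a homomorphism $\gamma\mathcal{S}_0\otimes\gamma\mathcal{S}_1\to\gamma(\mathcal{S}_0\otimes\mathcal{S}_1)$.
   Context: Partial semigroup: partially defined associative operation (if one of $(rs)t$, $r(st)$ is defined so is the other and they agree). A function array over $S$ indexed by $\Lambda$ based on $X$: each $\lambda\in\Lambda$ is a partial function $X\to S$, such that for all $s_0,\dots,s_k\in S$ some $x\in X$ has $s_i\lambda(x)$ defined for all $i,\lambda$. Total: $S$ a semigroup and each $\lambda$ total. $\gamma S$: ultrafilters $\mathcal{U}$ on $S$ with $\{t: st\text{ defined}\}\in\mathcal{U}$ for all $s$, with $B\in\mathcal{U}*\mathcal{V}$ iff $\{s:\{t: st\text{ defined}, st\in B\}\in\mathcal{V}\}\in\mathcal{U}$. $\gamma X$: ultrafilters $\mathcal{U}$ on $X$ with $\{x: s\lambda(x)\text{ defined}\}\in\mathcal{U}$ for all $s,\lambda$; $\lambda$ extends via $B\in\lambda(\mathcal{U})$ iff $\lambda^{ -1}(B)\in\mathcal{U}$; $\gamma\mathcal{S}$ is the resulting total array over $\gamma S$ based on $\gamma X$. Tensor product: for arrays $\mathcal{S}_i$ over the same $S$ indexed by $\Lambda_i$ based on $X_i$, $\mathcal{S}_0\otimes\mathcal{S}_1$ is the array over $S$ indexed by the disjoint union $\Lambda_0\cup\Lambda_1\cup(\Lambda_0\times\Lambda_1)$, based on $X_0\times X_1$,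 with $\lambda_0(x_0,x_1)=\lambda_0(x_0)$, $\lambda_1(x_0,x_1)=\lambda_1(x_1)$, $(\lambda_0,\lambda_1)(x_0,x_1)=\lambda_0(x_0)\lambda_1(x_1)$ (defined when this product is). A homomorphism between total arrays over semigroups $A$, $B$ indexed by the same set and based on $Y$, $Z$ is a pair $(f,g)$, $f\colon Y\to Z$, $g\colon A\to B$ a semigroup homomorphism, with $\lambda(f(y))=g(\lambda(y))$. -}

module Defs where

open import Data.Maybe using (Maybe; just; nothing; _>>=_)
open import Data.Product using (Σ; ∃; _×_; _,_; proj₁; proj₂)
open import Data.Sum using (_⊎_; inj₁; inj₂)
open import Data.Empty using (⊥; ⊥-elim)
open import Data.Unit using (⊤; tt)
open import Data.List.NonEmpty using (List⁺; toList)
open import Data.List.Relation.Unary.All using (All)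
open import Relation.Nullary using (¬_)
open import Relation.Binary.PropositionalEquality using (_≡_; refl; subst)

_∈ᴹ_ : {A : Set} → Maybe A → (A → Set) → Set
just a ∈ᴹ B = B a
nothing ∈ᴹ B = ⊥

Defined : {A : Set} → Maybe A → Set
Defined m = m ∈ᴹ (λ _ → ⊤)

∈ᴹ-mono : {A : Set} {B C : A → Set} (m : Maybe A) →
          (∀ a → B a → C a) → m ∈ᴹ B → m ∈ᴹ C
∈ᴹ-mono (just a) h p = h a p

∈ᴹ-empty : {A : Set} (m : Maybe A) → m ∈ᴹ (λ _ → ⊥) → ⊥
∈ᴹ-empty (just a) p = p

∈ᴹ-pair : {A : Set} {B C : A → Set} (m : Maybe A) →
          m ∈ᴹ B → m ∈ᴹ C → m ∈ᴹ (λ a → B a × C a)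
∈ᴹ-pair (just a) p q = p , q

∈ᴹ-neg : {A : Set} {B : A → Set} (m : Maybe A) →
         Defined m → ¬ (m ∈ᴹ B) → m ∈ᴹ (λ a → ¬ B a)
∈ᴹ-neg (just a) _ h b = h b

∈ᴹ-bind : {A C : Set} (m : Maybe A) (f : A → Maybe C) →
          Defined (m >>= f) → m ∈ᴹ (λ a → Defined (f a))
∈ᴹ-bind (just a) f d = d

-- Partial semigroups: (rs)t is defined iff r(st) is, and then they agree

record PartialSemigroup : Set₁ where
  field
    Carrier : Set
    _·_     : Carrier → Carrier → Maybe Carrier
    assoc   : ∀ r s t → ((r · s) >>= λ u → u · t) ≡ ((s · t) >>= λ v → r · v)

record ArrayData (S : PartialSemigroup) (Λ : Set) : Set₁ where
  open PartialSemigroup S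
  field
    Base : Set
    ev   : Λ → Base → Maybe Carrier

module _ {S : PartialSemigroup} {Λ : Set} where
  open PartialSemigroup S
  open ArrayData

  actL : (A : ArrayData S Λ) → Carrier → Λ → Base A → Maybe Carrier
  actL A s l x = ev A l x >>= λ a → s · a

  IsFunctionArray : ArrayData S Λ → Set
  IsFunctionArray A =
    (ss : List⁺ Carrier) →
    ∃ λ (x : Base A) → All (λ s → ∀ l → Defined (actL A s l x)) (toList ss)

_⊗_ : {S : PartialSemigroup} {Λ₀ Λ₁ : Set} →
      ArrayData S Λ₀ → ArrayData S Λ₁ → ArrayData S (Λ₀ ⊎ (Λ₁ ⊎ (Λ₀ × Λ₁)))
_⊗_ {S} A₀ A₁ = record
  { Base = ArrayData.Base A₀ × ArrayData.Base A₁
  ; ev   = ev' }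
  where
  open PartialSemigroup S
  ev' : _ → _ → Maybe Carrier
  ev' (inj₁ l) (x , y) = ArrayData.ev A₀ l x
  ev' (inj₂ (inj₁ m)) (x , y) = ArrayData.ev A₁ m y
  ev' (inj₂ (inj₂ (l , m))) (x , y) =
    ArrayData.ev A₀ l x >>= λ a → ArrayData.ev A₁ m y >>= λ b → a · b

record IsUltrafilter {A : Set} (U : (A → Set) → Set) : Set₁ where
  field
    univ   : U (λ _ → ⊤)
    proper : ¬ U (λ _ → ⊥)
    mono   : ∀ {B C : A → Set} → (∀ a → B a → C a) → U B → U C
    inter  : ∀ {B C : A → Set} → U B → U C → U (λ a → B a × C a)
    ultra  : ∀ (B : A → Set) → U B ⊎ U (λ a → ¬ B a)

record Ultrafilter (A : Set) : Set₁ where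
  field
    mem  : (A → Set) → Set
    isUF : IsUltrafilter mem
  open IsUltrafilter isUF public

_≈ᵁ_ : {A : Set} → Ultrafilter A → Ultrafilter A → Set₁
U ≈ᵁ V = ∀ B → (Ultrafilter.mem U B → Ultrafilter.mem V B)
             × (Ultrafilter.mem V B → Ultrafilter.mem U B)

module _ (S : PartialSemigroup) where
  open PartialSemigroup S

  record γS : Set₁ where
    field
      uf  : Ultrafilter Carrier
      adm : ∀ s → Ultrafilter.mem uf (λ t → Defined (s · t))

  _≈γ_ : γS → γS → Set₁
  U ≈γ V = γS.uf U ≈ᵁ γS.uf V

  _*_ : γS → γS → γS
  U * V = record { uf = W ; adm = admW }
    where
    module U = Ultrafilter (γS.uf U)
    module V = Ultrafilter (γS.uf V)
    memW : (Carrier → Set) → Set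
    memW B = U.mem (λ s → V.mem (λ t → (s · t) ∈ᴹ B))
    isW : IsUltrafilter memW
    isW = record
      { univ   = U.mono (λ s _ → γS.adm V s) U.univ
      ; proper = λ p → U.proper
          (U.mono (λ s q → V.proper (V.mono (λ t r → ∈ᴹ-empty (s · t) r) q)) p)
      ; mono   = λ h → U.mono (λ s → V.mono (λ t → ∈ᴹ-mono (s · t) h))
      ; inter  = λ p q → U.mono (λ s pq → V.mono (λ t r → ∈ᴹ-pair (s · t) (proj₁ r) (proj₂ r))
                                               (V.inter (proj₁ pq) (proj₂ pq)))
                                (U.inter p q)
      ; ultra  = λ B → ultraW B }
      where
      ultraW : ∀ B → memW B ⊎ memW (λ a → ¬ B a)
      ultraW B with U.ultra (λ s → V.mem (λ t → (s · t) ∈ᴹ B))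
      ... | inj₁ p = inj₁ p
      ... | inj₂ p = inj₂ (U.mono step p)
        where
        step : ∀ s → ¬ V.mem (λ t → (s · t) ∈ᴹ B) → V.mem (λ t → (s · t) ∈ᴹ (λ a → ¬ B a))
        step s np with V.ultra (λ t → (s · t) ∈ᴹ B)
        ... | inj₁ q = ⊥-elim (np q)
        ... | inj₂ q = V.mono (λ t r → ∈ᴹ-neg (s · t) (proj₁ r) (proj₂ r))
                              (V.inter (γS.adm V s) q)
    W : Ultrafilter Carrier
    W = record { mem = memW ; isUF = isW }
    admW : ∀ s → memW (λ t → Defined (s · t))
    admW s = U.mono step (γS.adm U s)
      where
      step : ∀ r → Defined (s · r) → V.mem (λ t → (r · t) ∈ᴹ (λ w → Defined (s · w)))
      step r d with s · r in eq
      ... | just u = V.mono (λ t e → ∈ᴹ-bind (r · t) (s ·_)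
                                 (subst Defined (lemma t) e))
                            (γS.adm V u)
        where
        lemma : ∀ t → u · t ≡ ((r · t) >>= λ v → s · v)
        lemma t = subst (λ m → (m >>= λ w → w · t) ≡ ((r · t) >>= λ v → s · v))
                        eq (assoc s r t)

module _ {S : PartialSemigroup} {Λ : Set} (A : ArrayData S Λ) where
  open PartialSemigroup S
  open ArrayData A

  record γX : Set₁ where
    field
      uf  : Ultrafilter Base
      dom : ∀ l → Ultrafilter.mem uf (λ x → Defined (ev l x))
      adm : ∀ s l → Ultrafilter.mem uf (λ x → Defined (actL A s l x))

  _≈X_ : γX → γX → Set₁
  U ≈X V = γX.uf U ≈ᵁ γX.uf V

  γev : Λ → γX → γS S
  γev l U = record { uf = record { mem = memP ; isUF = isP } ; adm = admP }
    where
    module U = Ultrafilter (γX.uf U)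
    memP : (Carrier → Set) → Set
    memP B = U.mem (λ x → ev l x ∈ᴹ B)
    isP : IsUltrafilter memP
    isP = record
      { univ   = γX.dom U l
      ; proper = λ p → U.proper (U.mono (λ x q → ∈ᴹ-empty (ev l x) q) p)
      ; mono   = λ h → U.mono (λ x → ∈ᴹ-mono (ev l x) h)
      ; inter  = λ p q → U.mono (λ x r → ∈ᴹ-pair (ev l x) (proj₁ r) (proj₂ r)) (U.inter p q)
      ; ultra  = λ B → ultraP B }
      where
      ultraP : ∀ B → memP B ⊎ memP (λ a → ¬ B a)
      ultraP B with U.ultra (λ x → ev l x ∈ᴹ B)
      ... | inj₁ p = inj₁ p
      ... | inj₂ p = inj₂ (U.mono (λ x r → ∈ᴹ-neg (ev l x) (proj₁ r) (proj₂ r))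
                                  (U.inter (γX.dom U l) p))
    admP : ∀ s → memP (λ t → Defined (s · t))
    admP s = U.mono (λ x → ∈ᴹ-bind (ev l x) (s ·_)) (γX.adm U s l)

record TotalArray (S : PartialSemigroup) (Λ : Set) : Set₂ where
  field
    Base : Set₁
    _≈B_ : Base → Base → Set₁
    ev   : Λ → Base → γS S

γ𝒮 : {S : PartialSemigroup} {Λ : Set} → ArrayData S Λ → TotalArray S Λ
γ𝒮 A = record { Base = γX A ; _≈B_ = _≈X_ A ; ev = γev A }

_⊗ₜ_ : {S : PartialSemigroup} {Λ₀ Λ₁ : Set} →
       TotalArray S Λ₀ → TotalArray S Λ₁ → TotalArray S (Λ₀ ⊎ (Λ₁ ⊎ (Λ₀ × Λ₁)))
_⊗ₜ_ {S} T₀ T₁ = record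
  { Base = TotalArray.Base T₀ × TotalArray.Base T₁
  ; _≈B_ = λ p q → TotalArray._≈B_ T₀ (proj₁ p) (proj₁ q) × TotalArray._≈B_ T₁ (proj₂ p) (proj₂ q)
  ; ev   = ev' }
  where
  ev' : _ → _ → γS S
  ev' (inj₁ l) (x , y) = TotalArray.ev T₀ l x
  ev' (inj₂ (inj₁ m)) (x , y) = TotalArray.ev T₁ m y
  ev' (inj₂ (inj₂ (l , m))) (x , y) = _*_ S (TotalArray.ev T₀ l x) (TotalArray.ev T₁ m y)

record Hom {S : PartialSemigroup} {Λ : Set} (T₁ T₂ : TotalArray S Λ) : Set₂ where
  open TotalArray
  field
    f      : Base T₁ → Base T₂
    g      : γS S → γS S
    f-cong : ∀ {y y'} → _≈B_ T₁ y y' → _≈B_ T₂ (f y) (f y')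
    g-cong : ∀ {u v} → _≈γ_ S u v → _≈γ_ S (g u) (g v)
    g-hom  : ∀ u v → _≈γ_ S (g (_*_ S u v)) (_*_ S (g u) (g v))
    comm   : ∀ l y → _≈γ_ S (ev T₂ l (f y)) (g (ev T₁ l y))

-- The map is (U , V) ↦ U ⊠ V, the Fubini product ultrafilter on X₀ × X₁, with the
-- identity on γS. Pushing U ⊠ V forward along an index of the tensor product gives
-- the value of that index in γ𝒮₀ ⊗ γ𝒮₁: for λ₀ and λ₁ because an ultrafilter
-- contains a constant set exactly when that set is everything, and for (λ₀ , λ₁)
-- because the Fubini product turns the pointwise product λ₀(x) λ₁(y) into the
-- ultrafilter product λ₀(U) * λ₁(V).
module Submission where

open import Defs
open import Data.Nat using (ℕ)
open import Data.Fin using (Fin)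
open import Data.Maybe using (Maybe; just; nothing; _>>=_)
open import Data.Product using (_×_; _,_; proj₁; proj₂)
open import Data.Sum using (_⊎_; inj₁; inj₂)
open import Data.Empty using (⊥-elim)
open import Function using (id; _⇔_; mk⇔; Equivalence)
open import Function.Related.Propositional using (module EquationalReasoning)
open import Relation.Nullary using (¬_)

open Ultrafilter
open Equivalence using (to; from)

module _ {A : Set} (U : Ultrafilter A) where

  mem-disjoint : ∀ {B} → mem U B → ¬ mem U (λ a → ¬ B a)
  mem-disjoint b ¬b = proper U (mono U (λ _ x → proj₂ x (proj₁ x)) (inter U b ¬b))

  ¬mem⇒mem-¬ : ∀ {B} → ¬ mem U B → mem U (λ a → ¬ B a)
  ¬mem⇒mem-¬ {B} ¬b with ultra U B
  ... | inj₁ b   = ⊥-elim (¬b b)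
  ... | inj₂ b⁻ = b⁻

  mem-stable : ∀ {B} → ¬ ¬ mem U B → mem U B
  mem-stable {B} ¬¬b with ultra U B
  ... | inj₁ b   = b
  ... | inj₂ b⁻ = ⊥-elim (¬¬b (λ b → mem-disjoint b b⁻))

  mem-¬¬-mono : ∀ {B C} → (∀ a → B a → ¬ ¬ C a) → mem U B → mem U C
  mem-¬¬-mono {C = C} h b with ultra U C
  ... | inj₁ c   = c
  ... | inj₂ c⁻ =
    ⊥-elim (proper U (mono U (λ a x → h a (proj₁ x) (proj₂ x)) (inter U b c⁻)))

  mem-const : ∀ {P : Set} → P → mem U (λ _ → P)
  mem-const p = mono U (λ _ _ → p) (univ U)

  mem-const⁻ : ∀ {P : Set} → mem U (λ _ → P) → ¬ ¬ P
  mem-const⁻ p ¬p = proper U (mono U (λ _ → ¬p) p)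

  mem-cong : ∀ {B C} → (∀ a → B a ⇔ C a) → mem U B ⇔ mem U C
  mem-cong h = mk⇔ (mono U (λ a → to (h a))) (mono U (λ a → from (h a)))

_⊠_ : {A C : Set} → Ultrafilter A → Ultrafilter C → Ultrafilter (A × C)
mem (U ⊠ V) B = mem U (λ x → mem V (λ y → B (x , y)))
isUF (U ⊠ V) = record
  { univ   = mem-const U (univ V)
  ; proper = λ p → proper U (mono U (λ _ → proper V) p)
  ; mono   = λ h → mono U (λ x → mono V (λ y → h (x , y)))
  ; inter  = λ p q → mono U (λ _ r → inter V (proj₁ r) (proj₂ r)) (inter U p q)
  ; ultra  = ultra⊠ }
  where
  ultra⊠ : ∀ B → mem U (λ x → mem V (λ y → B (x , y)))
                 ⊎ mem U (λ x → mem V (λ y → ¬ B (x , y)))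
  ultra⊠ B with ultra U (λ x → mem V (λ y → B (x , y)))
  ... | inj₁ b   = inj₁ b
  ... | inj₂ b⁻ = inj₂ (mono U (λ _ → ¬mem⇒mem-¬ V) b⁻)

⊠-cong : {A C : Set} {U U' : Ultrafilter A} {V V' : Ultrafilter C} →
         U ≈ᵁ U' → V ≈ᵁ V' → (U ⊠ V) ≈ᵁ (U' ⊠ V')
⊠-cong {U = U} {U'} eU eV B =
  (λ p → proj₁ (eU _) (mono U (λ _ → proj₁ (eV _)) p)) ,
  (λ p → proj₂ (eU _) (mono U' (λ _ → proj₂ (eV _)) p))

module _ {A C : Set} (U : Ultrafilter A) (V : Ultrafilter C) where

  ⊠-proj₁ : ∀ {P} → mem (U ⊠ V) (λ z → P (proj₁ z)) ⇔ mem U P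
  ⊠-proj₁ = mk⇔ (mem-¬¬-mono U (λ _ → mem-const⁻ V)) (mono U (λ _ → mem-const V))

  ⊠-proj₂ : ∀ {Q} → mem (U ⊠ V) (λ z → Q (proj₂ z)) ⇔ mem V Q
  ⊠-proj₂ = mk⇔ (λ q → mem-stable V (mem-const⁻ U q)) (mem-const U)

∈ᴹ-cong : {A : Set} {B C : A → Set} (m : Maybe A) →
          (∀ a → B a ⇔ C a) → m ∈ᴹ B ⇔ m ∈ᴹ C
∈ᴹ-cong (just a) h = h a
∈ᴹ-cong nothing  h = mk⇔ id id

∈ᴹ->>= : {A C : Set} {B : C → Set} (m : Maybe A) {f : A → Maybe C} →
         (m >>= f) ∈ᴹ B ⇔ m ∈ᴹ (λ a → f a ∈ᴹ B)
∈ᴹ->>= (just a) = mk⇔ id id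
∈ᴹ->>= nothing  = mk⇔ id id

mem-∈ᴹ : {A C : Set} (V : Ultrafilter C) (m : Maybe A) {P : A → C → Set} →
         mem V (λ y → m ∈ᴹ (λ a → P a y)) ⇔ m ∈ᴹ (λ a → mem V (P a))
mem-∈ᴹ V (just a) = mk⇔ id id
mem-∈ᴹ V nothing  = mk⇔ (proper V) ⊥-elim

module _ {S : PartialSemigroup} {Λ₀ Λ₁ : Set}
         (𝒮₀ : ArrayData S Λ₀) (𝒮₁ : ArrayData S Λ₁) where
  open PartialSemigroup S
  open ArrayData using (ev)

  ev⊗ : Λ₀ ⊎ (Λ₁ ⊎ (Λ₀ × Λ₁)) → γX 𝒮₀ × γX 𝒮₁ → γS S
  ev⊗ = TotalArray.ev (γ𝒮 𝒮₀ ⊗ₜ γ𝒮 𝒮₁)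

  ev-⊠ : (U : γX 𝒮₀) (V : γX 𝒮₁) (k : Λ₀ ⊎ (Λ₁ ⊎ (Λ₀ × Λ₁))) (B : Carrier → Set) →
         mem (γX.uf U ⊠ γX.uf V) (λ z → ev (𝒮₀ ⊗ 𝒮₁) k z ∈ᴹ B)
         ⇔ mem (γS.uf (ev⊗ k (U , V))) B
  ev-⊠ U V (inj₁ l)         B = ⊠-proj₁ (γX.uf U) (γX.uf V)
  ev-⊠ U V (inj₂ (inj₁ m))  B = ⊠-proj₂ (γX.uf U) (γX.uf V)
  ev-⊠ U V (inj₂ (inj₂ (l , m))) B = begin
    mem U⁰ (λ x → mem V⁰ (λ y → (ev 𝒮₀ l x >>= λ a → ev 𝒮₁ m y >>= (a ·_)) ∈ᴹ B))
      ∼⟨ mem-cong U⁰ (λ x → mem-cong V⁰ (λ _ → ∈ᴹ->>= (ev 𝒮₀ l x))) ⟩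
    mem U⁰ (λ x → mem V⁰ (λ y → ev 𝒮₀ l x ∈ᴹ (λ a → (ev 𝒮₁ m y >>= (a ·_)) ∈ᴹ B)))
      ∼⟨ mem-cong U⁰ (λ x → mem-∈ᴹ V⁰ (ev 𝒮₀ l x)) ⟩
    mem U⁰ (λ x → ev 𝒮₀ l x ∈ᴹ (λ a → mem V⁰ (λ y → (ev 𝒮₁ m y >>= (a ·_)) ∈ᴹ B)))
      ∼⟨ mem-cong U⁰ (λ x → ∈ᴹ-cong (ev 𝒮₀ l x) (λ _ → mem-cong V⁰ (λ y → ∈ᴹ->>= (ev 𝒮₁ m y)))) ⟩
    mem U⁰ (λ x → ev 𝒮₀ l x ∈ᴹ (λ a → mem V⁰ (λ y → ev 𝒮₁ m y ∈ᴹ (λ b → (a · b) ∈ᴹ B))))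
      ∎
    where
    open EquationalReasoning
    U⁰ = γX.uf U
    V⁰ = γX.uf V

  γX-⊠ : γX 𝒮₀ × γX 𝒮₁ → γX (𝒮₀ ⊗ 𝒮₁)
  γX-⊠ (U , V) = record
    { uf  = γX.uf U ⊠ γX.uf V
    ; dom = λ k → from (ev-⊠ U V k _) (univ (γS.uf (ev⊗ k (U , V))))
    ; adm = λ s k → mono (γX.uf U ⊠ γX.uf V) (λ z → from (∈ᴹ->>= (ev (𝒮₀ ⊗ 𝒮₁) k z)))
                         (from (ev-⊠ U V k _) (γS.adm (ev⊗ k (U , V)) s)) }

  γ⊗-hom : Hom (γ𝒮 𝒮₀ ⊗ₜ γ𝒮 𝒮₁) (γ𝒮 (𝒮₀ ⊗ 𝒮₁))
  γ⊗-hom = record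
    { f      = γX-⊠
    ; g      = id
    ; f-cong = λ { {U , V} {U' , V'} (eU , eV) →
                   ⊠-cong {U = γX.uf U} {γX.uf U'} {γX.uf V} {γX.uf V'} eU eV }
    ; g-cong = id
    ; g-hom  = λ _ _ _ → id , id
    ; comm   = λ k (U , V) B → to (ev-⊠ U V k B) , from (ev-⊠ U V k B) }

-- Neither finiteness of the index sets nor the array condition is needed.
proposition3p2 : (S : PartialSemigroup) (n₀ n₁ : ℕ)
    (𝒮₀ : ArrayData S (Fin n₀)) (𝒮₁ : ArrayData S (Fin n₁)) →
    IsFunctionArray 𝒮₀ → IsFunctionArray 𝒮₁ →
    Hom (γ𝒮 𝒮₀ ⊗ₜ γ𝒮 𝒮₁) (γ𝒮 (𝒮₀ ⊗ 𝒮₁))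
proposition3p2 S n₀ n₁ 𝒮₀ 𝒮₁ _ _ = γ⊗-hom 𝒮₀ 𝒮₁
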